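{- Let $G=(V,E)$ be a graph with at least one edge, and consider the polymatroid $f:\mathcal{P}(V)\to\mathbb{Z}_{\ge0}$, $f(S)=|\{e\in E: e \text{ has at least one endpoint in } S\}|$ (the Minimum Entropy Orientation instance). Then for any run of the greedy algorithm on $(V,f)$, the covering coefficient satisfies $\alpha_G=1$.
   Context: Greedy algorithm on $(V,f)$: start with $S=\emptyset$; while $f(S)<f(V)$, choose $i\in V\setminus S$ maximizing $f(S\cup\{i\})-f(S)$ (ties broken arbitrarily) and set $S:=S\cup\{i\}$. The chosen elements in order are $i_1,\dots,i_l$; $W_r=\{i_1,\dots,i_r\}$, $W_0=\emptyset$; $\Delta_r=f(W_r)-f(W_{r-1})$. For $1\le r\le l$, $j\in V$: $a_r^j=f(W_r)-f(W_{r-1})-\big(f(W_r\cup\{j\})-f(W_{r-1}\cup\{j\})\big)$. A cover of $f$ is a modular function $g:\mathcal{P}(V)\to\mathbb{Z}_{\ge0}$ with $g(V)=f(V)$ and $0\le g(S)\le f(S)$ for all $S$, identified with the vector $(g(\{j\}))_j$; with $n=f(V)$ its entropy is $-\sum_j\frac{g(\{j\})}{n}\log_2\frac{g(\{j\})}{n}$. The covering coefficient $\alpha_G$ is the smallest $\alpha>0$ such that there exist a minimum-entropy cover $(X_j)_{j\in V}$ and integers $Z_r^j$ with $0\le Z_r^j\le a_r^j$, $\sum_{r=1}^l Z_r^j=X_j$ for all $j$, and $\sum_j Z_r^j\le\alpha\Delta_r$ for all $r$. -}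

module Defs where

open import Data.Bool using (Bool; true; false; if_then_else_; _∧_; _∨_)
open import Data.Nat as ℕ using (ℕ; zero; suc; _+_; _*_; _^_; _≤_; _<_; _<ᵇ_)
open import Data.Integer as ℤ using (ℤ; +_)
open import Data.Fin using (Fin; toℕ) renaming (zero to fz; suc to fs)
open import Data.Fin.Subset using (Subset; ⁅_⁆; _∪_; ⊥; ⊤)
open import Data.Vec using (lookup)
open import Data.List using (List; []; _∷_; take; length)
open import Data.Product using (Σ; ∃; _×_; _,_)
open import Relation.Binary.PropositionalEquality using (_≡_)

sumFin : ∀ {n} → (Fin n → ℕ) → ℕ
sumFin {zero}  g = 0
sumFin {suc n} g = g fz + sumFin (λ i → g (fs i))

sumFinℤ : ∀ {n} → (Fin n → ℤ) → ℤ
sumFinℤ {zero}  g = + 0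
sumFinℤ {suc n} g = g fz ℤ.+ sumFinℤ (λ i → g (fs i))

prodFin : ∀ {n} → (Fin n → ℕ) → ℕ
prodFin {zero}  g = 1
prodFin {suc n} g = g fz * prodFin (λ i → g (fs i))

record Graph (n : ℕ) : Set where
  field
    adj      : Fin n → Fin n → Bool
    symmetric : ∀ i j → adj i j ≡ adj j i
    irreflexive : ∀ i → adj i i ≡ false
open Graph public

HasEdge : ∀ {n} → Graph n → Set
HasEdge G = ∃ λ i → ∃ λ j → adj G i j ≡ true

-- f(S) = number of edges {i,j} (counted once, via toℕ i < toℕ j) with an endpoint in S.
edgeFn : ∀ {n} → Graph n → Subset n → ℕ
edgeFn G S = sumFin λ i → sumFin λ j →
  if (toℕ i <ᵇ toℕ j) ∧ adj G i j ∧ (lookup S i ∨ lookup S j) then 1 else 0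

data GreedyFrom {n : ℕ} (f : Subset n → ℕ) : Subset n → List (Fin n) → Set where
  done : ∀ {S} → f S ≡ f ⊤ → GreedyFrom f S []
  step : ∀ {S i rest} →
         f S < f ⊤ →
         lookup S i ≡ false →
         (∀ k → lookup S k ≡ false → f (S ∪ ⁅ k ⁆) ≤ f (S ∪ ⁅ i ⁆)) →
         GreedyFrom f (S ∪ ⁅ i ⁆) rest →
         GreedyFrom f S (i ∷ rest)

GreedyRun : ∀ {n} → (Subset n → ℕ) → List (Fin n) → Set
GreedyRun f seq = GreedyFrom f ⊥ seq

setOf : ∀ {n} → List (Fin n) → Subset n
setOf []       = ⊥
setOf (i ∷ xs) = ⁅ i ⁆ ∪ setOf xs

W : ∀ {n} → List (Fin n) → ℕ → Subset n
W seq r = setOf (take r seq)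

-- For r : Fin l (l = length seq), the index r stands for the paper's r+1:
-- Δ_{r+1} = f(W_{r+1}) - f(W_r).
Δ : ∀ {n} → (Subset n → ℕ) → (seq : List (Fin n)) → Fin (length seq) → ℤ
Δ f seq r = + f (W seq (suc (toℕ r))) ℤ.- + f (W seq (toℕ r))

aCoef : ∀ {n} → (Subset n → ℕ) → (seq : List (Fin n)) → Fin (length seq) → Fin n → ℤ
aCoef f seq r j = Δ f seq r ℤ.-
  (+ f (W seq (suc (toℕ r)) ∪ ⁅ j ⁆) ℤ.- + f (W seq (toℕ r) ∪ ⁅ j ⁆))

modular : ∀ {n} → (Fin n → ℕ) → Subset n → ℕ
modular X S = sumFin λ j → if lookup S j then X j else 0

Cover : ∀ {n} → (Subset n → ℕ) → (Fin n → ℕ) → Set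
Cover f X = (modular X ⊤ ≡ f ⊤) × (∀ S → modular X S ≤ f S)

-- Entropy comparison without reals: for covers with the same total n = f(V),
-- H(X) = log₂ n - (1/n) Σ_j X_j log₂ X_j, so H(X) ≤ H(Y) iff
-- Π_j X_j^{X_j} ≥ Π_j Y_j^{Y_j} (with 0^0 = 1).
entropyWeight : ∀ {n} → (Fin n → ℕ) → ℕ
entropyWeight X = prodFin λ j → X j ^ X j

MinEntropyCover : ∀ {n} → (Subset n → ℕ) → (Fin n → ℕ) → Set
MinEntropyCover f X = Cover f X × (∀ Y → Cover f Y → entropyWeight Y ≤ entropyWeight X)

-- α = p/q (q > 0) is admissible in the definition of the covering coefficient.
Admissible : ∀ {n} → (Subset n → ℕ) → (seq : List (Fin n)) → ℕ → ℕ → Set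
Admissible {n} f seq p q =
  Σ (Fin n → ℕ) λ X → MinEntropyCover f X ×
  Σ (Fin (length seq) → Fin n → ℤ) λ Z →
      (∀ r j → (+ 0 ℤ.≤ Z r j) × (Z r j ℤ.≤ aCoef f seq r j))
    × (∀ j → sumFinℤ (λ r → Z r j) ≡ + X j)
    × (∀ r → sumFinℤ (λ j → Z r j) ℤ.* + q ℤ.≤ + p ℤ.* Δ f seq r)

CoveringCoefficientIsOne : ∀ {n} → (Subset n → ℕ) → List (Fin n) → Set
CoveringCoefficientIsOne f seq =
  Admissible f seq 1 1 ×
  (∀ p q → 0 < p → p < q → Admissible f seq p q → Data.Empty.⊥)
  where import Data.Empty

{-# OPTIONS --safe #-}
module Submission where

-- The edge function f of G is the coverage function S ↦ Σ_{p,q} [p ∈ S ∨ q ∈ S] w(p,q) of its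
-- edge multiset w. Every cover X of a coverage function is the in-degree vector of an orientation
-- (a Hakimi-type theorem, by induction on the number of edges): an edge uv can be oriented towards u
-- unless some tight set contains v but not u, and tight sets blocking both directions would
-- contradict the strict submodularity of f across uv. Orient a minimum-entropy cover X this way and
-- let Z_r^j count the edges first covered at greedy step r whose head is j. Its rows sum to Δ_r, its
-- columns to X_j, and Z_r^j ≤ a_r^j, the number of edges first covered at step r that are incident
-- to j; so α = 1 is admissible. Conversely, summing the row constraints of an admissible α = p/q
-- gives f(V)·q ≤ p·f(V), since Σ_r Δ_r and Σ_j X_j both equal f(V) > 0.

open import Defs
open import Algebra.Bundles using (CommutativeMonoid)
import Algebra.Properties.CommutativeSemigroup as CommutativeSemigroupProperties
import Algebra.Properties.Semiring.Sum as SemiringSum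
open import Data.Bool using (Bool; true; false; if_then_else_; _∧_; _∨_; not)
import Data.Bool.Properties as Bool
open import Data.Empty using (⊥-elim) renaming (⊥ to Empty)
open import Data.Fin using (Fin; toℕ) renaming (zero to fz; suc to fs)
open import Data.Fin.Properties using (toℕ-injective)
open import Data.Fin.Subset using (Subset; ⁅_⁆; _∪_; _∩_; ∁; ⊤; ⊥; _⊆_)
open import Data.Fin.Subset.Properties
  using (anySubset?; x∈⁅y⁆⇒x≡y; ⊥⊆; x∈p∪q⁺; x∈p∪q⁻; ∪-assoc; ∪-identityˡ; ∪-identityʳ)
import Data.Integer as ℤ
open import Data.Integer using (ℤ; +≤+)
import Data.Integer.Properties as ℤP
open import Data.Integer.Tactic.RingSolver using (solve-∀)
open import Data.List using (List; []; _∷_; length; upTo; cartesianProductWith; filter)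
open import Data.List.Membership.Propositional using (_∈_)
open import Data.List.Membership.Propositional.Properties using (∈-cartesianProductWith⁺; ∈-upTo⁺; ∈-filter⁺)
open import Data.List.Properties using (take-all)
import Data.List.Relation.Unary.All as All
open import Data.List.Relation.Unary.All.Properties using (all-filter)
open import Data.List.Relation.Unary.Any using (here)
open import Data.Nat using (ℕ; zero; suc; _+_; _*_; _∸_; _^_; _≤_; _<_; _<ᵇ_; z≤n; s≤s; _≟_; _≤?_; >-nonZero)
open import Data.Nat.Properties
open import Data.List.Extrema ≤-totalOrder using (argmax; argmax-all; f[xs]≤f[argmax])
open import Data.Product using (Σ; ∃; ∃-syntax; _×_; _,_; proj₁; proj₂)
open import Data.Sum using (inj₁; inj₂)
import Data.Sum as Sum
open import Data.Vec using (Vec; []; _∷_; lookup; tabulate)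
open import Data.Vec.Properties
  using (lookup-replicate; lookup-zipWith; lookup-map; lookup⇒[]=; []=⇒lookup; lookup∘tabulate)
open import Function using (_∘_)
open import Function.Bundles using (Equivalence)
open import Relation.Binary.Definitions using (tri<; tri≈; tri>)
open import Relation.Binary.PropositionalEquality
open import Relation.Nullary using (¬_; ¬?; contradiction; Dec; yes; no; _×-dec_)
open import Relation.Nullary.Decidable using (map′; decidable-stable)

open CommutativeSemigroupProperties (CommutativeMonoid.commutativeSemigroup Bool.∨-commutativeMonoid)
  using () renaming (interchange to ∨-interchange)
open CommutativeSemigroupProperties +-commutativeSemigroup using (xy∙z≈xz∙y)

private
  variable
    n : ℕ

-- Defs writes this Iverson product as if b then x else 0, so lemmas about when apply to modular
-- and edgeFn as they stand.
when : Bool → ℕ → ℕ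
when b x = if b then x else 0

when-distrib-+ : ∀ b x y → when b (x + y) ≡ when b x + when b y
when-distrib-+ true  x y = refl
when-distrib-+ false x y = refl

when-comm : ∀ a b x → when a (when b x) ≡ when b (when a x)
when-comm true  b x = refl
when-comm false true  x = refl
when-comm false false x = refl

when-zero : ∀ b → when b 0 ≡ 0
when-zero true  = refl
when-zero false = refl

when-≤ : ∀ b x → when b x ≤ x
when-≤ true  x = ≤-refl
when-≤ false x = z≤n

when-mono : ∀ {a b} → (a ≡ true → b ≡ true) → ∀ x → when a x ≤ when b x
when-mono {true}  a⇒b x rewrite a⇒b refl = ≤-refl
when-mono {false} a⇒b x = z≤n

when-monoʳ : ∀ b {x y} → x ≤ y → when b x ≤ when b y
when-monoʳ true  x≤y = x≤y
when-monoʳ false _   = z≤n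

when-∧ : ∀ a b x → when (a ∧ b) x ≡ when a (when b x)
when-∧ true  b x = refl
when-∧ false b x = refl

when-∨-∧ : ∀ a b x → when (a ∨ b) x + when (a ∧ b) x ≡ when a x + when b x
when-∨-∧ true  true  x = refl
when-∨-∧ true  false x = refl
when-∨-∧ false true  x = +-identityʳ x
when-∨-∧ false false x = refl

when-∨-+ : ∀ a b x y → when a x + when b y ≤ when (a ∨ b) (x + y)
when-∨-+ true  true  x y = ≤-refl
when-∨-+ true  false x y = +-monoʳ-≤ x z≤n
when-∨-+ false true  x y = m≤n+m y x
when-∨-+ false false x y = z≤n

when-not : ∀ b x → x ≡ when (not b) x + when b x
when-not true  x = refl
when-not false x = sym (+-identityʳ x)

when-split : ∀ {a b} → (a ≡ true → b ≡ true) → ∀ x → when b x ≡ when a x + when (not a ∧ b) x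
when-split {true}  a⇒b x rewrite a⇒b refl = sym (+-identityʳ x)
when-split {false} a⇒b x = refl

when-split-∨ : ∀ a b c x → when (not a ∧ b) x ≡ when (not (a ∨ c) ∧ (b ∨ c)) x + when ((not a ∧ b) ∧ c) x
when-split-∨ true  b     c     x = refl
when-split-∨ false true  true  x = refl
when-split-∨ false true  false x = sym (+-identityʳ x)
when-split-∨ false false true  x = refl
when-split-∨ false false false x = refl

when-absorbs : ∀ b {x y} → y ≤ x → when b x ≡ x → when b y ≡ y
when-absorbs true  _   _  = refl
when-absorbs false y≤x x≡0 = sym (n≤0⇒n≡0 (subst (_ ≤_) (sym x≡0) y≤x))

∧-∨-⇒ : ∀ a b c d → (a ∧ c) ∨ (b ∧ d) ≡ true → (a ∨ b) ∧ (c ∨ d) ≡ true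
∧-∨-⇒ true  b     true  d     _  = refl
∧-∨-⇒ true  b     false true  _  = refl
∧-∨-⇒ true  true  false false ()
∧-∨-⇒ true  false false false ()
∧-∨-⇒ false true  c     true  _  = Bool.∨-zeroʳ c
∧-∨-⇒ false true  c     false ()
∧-∨-⇒ false false c     d     ()

∨-mono : ∀ {a a′ b b′} → (a ≡ true → a′ ≡ true) → (b ≡ true → b′ ≡ true) → a ∨ b ≡ true → a′ ∨ b′ ≡ true
∨-mono {true}  {a′} a⇒ b⇒ _ rewrite a⇒ refl = refl
∨-mono {false} {a′} {true} a⇒ b⇒ _ rewrite b⇒ refl = Bool.∨-zeroʳ a′

lookup-⊤ : (x : Fin n) → lookup ⊤ x ≡ true
lookup-⊤ x = lookup-replicate x true

lookup-⊥ : (x : Fin n) → lookup ⊥ x ≡ false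
lookup-⊥ x = lookup-replicate x false

lookup-∪ : (S T : Subset n) (x : Fin n) → lookup (S ∪ T) x ≡ lookup S x ∨ lookup T x
lookup-∪ S T x = lookup-zipWith _∨_ x S T

lookup-∩ : (S T : Subset n) (x : Fin n) → lookup (S ∩ T) x ≡ lookup S x ∧ lookup T x
lookup-∩ S T x = lookup-zipWith _∧_ x S T

lookup-∁ : (S : Subset n) (x : Fin n) → lookup (∁ S) x ≡ not (lookup S x)
lookup-∁ S x = lookup-map x not S

lookup-⁅x⁆-x : (x : Fin n) → lookup ⁅ x ⁆ x ≡ true
lookup-⁅x⁆-x fz     = refl
lookup-⁅x⁆-x (fs x) = lookup-⁅x⁆-x x

lookup-⁅⁆-sym : (x y : Fin n) → lookup ⁅ x ⁆ y ≡ lookup ⁅ y ⁆ x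
lookup-⁅⁆-sym fz     fz     = refl
lookup-⁅⁆-sym fz     (fs y) = lookup-⊥ y
lookup-⁅⁆-sym (fs x) fz     = sym (lookup-⊥ x)
lookup-⁅⁆-sym (fs x) (fs y) = lookup-⁅⁆-sym x y

lookup-⁅⁆⇒≡ : {x y : Fin n} → lookup ⁅ y ⁆ x ≡ true → x ≡ y
lookup-⁅⁆⇒≡ {x = x} {y} eq = x∈⁅y⁆⇒x≡y y (lookup⇒[]= x ⁅ y ⁆ eq)

⊆⇒lookup : {S S′ : Subset n} → S ⊆ S′ → ∀ {x} → lookup S x ≡ true → lookup S′ x ≡ true
⊆⇒lookup {S = S} {S′} S⊆S′ {x} x∈S = []=⇒lookup (S⊆S′ (lookup⇒[]= x S x∈S))

⊆-∪ : {S S′ : Subset n} → S ⊆ S′ → ∀ T → S ∪ T ⊆ S′ ∪ T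
⊆-∪ {S = S} S⊆S′ T x∈ = x∈p∪q⁺ (Sum.map₁ S⊆S′ (x∈p∪q⁻ S T x∈))

module ℕ∑ = SemiringSum +-*-semiring

sumFin≡sum : (g : Fin n → ℕ) → sumFin g ≡ ℕ∑.sum g
sumFin≡sum {zero}  g = refl
sumFin≡sum {suc n} g = cong (g fz +_) (sumFin≡sum (g ∘ fs))

sumFin-cong : {g h : Fin n → ℕ} → g ≗ h → sumFin g ≡ sumFin h
sumFin-cong {zero}  e = refl
sumFin-cong {suc n} e = cong₂ _+_ (e fz) (sumFin-cong (e ∘ fs))

sumFin-mono-≤ : {g h : Fin n → ℕ} → (∀ i → g i ≤ h i) → sumFin g ≤ sumFin h
sumFin-mono-≤ {zero}  le = z≤n
sumFin-mono-≤ {suc n} le = +-mono-≤ (le fz) (sumFin-mono-≤ (le ∘ fs))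

sumFin-mono-< : {g h : Fin n → ℕ} → (∀ i → g i ≤ h i) → ∀ k → g k < h k → sumFin g < sumFin h
sumFin-mono-< le fz     lt = +-mono-<-≤ lt (sumFin-mono-≤ (le ∘ fs))
sumFin-mono-< le (fs k) lt = +-mono-≤-< (le fz) (sumFin-mono-< (le ∘ fs) k lt)

sumFin-distrib-+ : (g h : Fin n → ℕ) → sumFin (λ i → g i + h i) ≡ sumFin g + sumFin h
sumFin-distrib-+ g h = begin
  sumFin (λ i → g i + h i)     ≡⟨ sumFin≡sum (λ i → g i + h i) ⟩
  ℕ∑.sum (λ i → g i + h i)     ≡⟨ ℕ∑.∑-distrib-+ g h ⟩
  ℕ∑.sum g + ℕ∑.sum h          ≡⟨ sym (cong₂ _+_ (sumFin≡sum g) (sumFin≡sum h)) ⟩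
  sumFin g + sumFin h          ∎
  where open ≡-Reasoning

sumFin-comm : ∀ {m} (f : Fin m → Fin n → ℕ) →
              sumFin (λ i → sumFin (f i)) ≡ sumFin (λ j → sumFin (λ i → f i j))
sumFin-comm f = begin
  sumFin (λ i → sumFin (f i))                ≡⟨ nested f ⟩
  ℕ∑.sum (λ i → ℕ∑.sum (f i))                ≡⟨ ℕ∑.∑-comm f ⟩
  ℕ∑.sum (λ j → ℕ∑.sum (λ i → f i j))        ≡⟨ sym (nested (λ j i → f i j)) ⟩
  sumFin (λ j → sumFin (λ i → f i j))        ∎
  where
  open ≡-Reasoning
  nested : ∀ {k l} (h : Fin k → Fin l → ℕ) → sumFin (λ i → sumFin (h i)) ≡ ℕ∑.sum (λ i → ℕ∑.sum (h i))
  nested h = trans (sumFin-cong (sumFin≡sum ∘ h)) (sumFin≡sum (λ i → ℕ∑.sum (h i)))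

sumFin-zero : sumFin {n} (λ _ → 0) ≡ 0
sumFin-zero {n} = trans (sumFin≡sum {n} (λ _ → 0)) (ℕ∑.sum-replicate-zero n)

sumFin-when : ∀ b (g : Fin n → ℕ) → sumFin (λ i → when b (g i)) ≡ when b (sumFin g)
sumFin-when true  g = refl
sumFin-when {n} false g = sumFin-zero {n}

term≤sumFin : (g : Fin n → ℕ) → ∀ i → g i ≤ sumFin g
term≤sumFin g fz     = m≤m+n _ _
term≤sumFin g (fs i) = ≤-trans (term≤sumFin (g ∘ fs) i) (m≤n+m _ _)

sumFin-positive : (g : Fin n → ℕ) → 0 < sumFin g → ∃[ i ] 0 < g i
sumFin-positive {suc n} g pos with g fz in eq
... | suc _ = fz , subst (0 <_) (sym eq) (s≤s z≤n)
... | zero  with sumFin-positive (g ∘ fs) pos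
...   | i , gi>0 = fs i , gi>0

sumFin-≤-cancel : {g h : Fin n → ℕ} → (∀ i → g i ≤ h i) → sumFin h ≤ sumFin g → g ≗ h
sumFin-≤-cancel {g = g} {h} le ge i with m≤n⇒m<n∨m≡n (le i)
... | inj₁ lt = contradiction (sumFin-mono-< le i lt) (≤⇒≯ ge)
... | inj₂ eq = eq

sumFin-pick : (x : Fin n) (c : Fin n → ℕ) → sumFin (λ j → when (lookup ⁅ x ⁆ j) (c j)) ≡ c x
sumFin-pick {suc n} fz c = begin
  c fz + sumFin (λ j → when (lookup ⊥ j) (c (fs j)))
    ≡⟨ cong (c fz +_) (sumFin-cong λ j → cong (λ b → when b (c (fs j))) (lookup-⊥ j)) ⟩
  c fz + sumFin {n} (λ _ → 0)                          ≡⟨ cong (c fz +_) (sumFin-zero {n}) ⟩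
  c fz + 0                                             ≡⟨ +-identityʳ (c fz) ⟩
  c fz                                                 ∎
  where open ≡-Reasoning
sumFin-pick (fs x) c = sumFin-pick x (c ∘ fs)

-- Edge multiplicities of a multigraph on Fin n: w p q edges from p to q, loops allowed.
Weights : ℕ → Set
Weights n = Fin n → Fin n → ℕ

sumFin² : Weights n → ℕ
sumFin² w = sumFin λ p → sumFin (w p)

sumFin²-cong : {w w′ : Weights n} → (∀ p q → w p q ≡ w′ p q) → sumFin² w ≡ sumFin² w′
sumFin²-cong e = sumFin-cong λ p → sumFin-cong (e p)

sumFin²-mono-≤ : {w w′ : Weights n} → (∀ p q → w p q ≤ w′ p q) → sumFin² w ≤ sumFin² w′
sumFin²-mono-≤ le = sumFin-mono-≤ λ p → sumFin-mono-≤ (le p)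

sumFin²-mono-< : {w w′ : Weights n} → (∀ p q → w p q ≤ w′ p q) →
                 ∀ u v → w u v < w′ u v → sumFin² w < sumFin² w′
sumFin²-mono-< le u v lt = sumFin-mono-< (λ p → sumFin-mono-≤ (le p)) u (sumFin-mono-< (le u) v lt)

sumFin²-distrib-+ : (w w′ : Weights n) → sumFin² (λ p q → w p q + w′ p q) ≡ sumFin² w + sumFin² w′
sumFin²-distrib-+ w w′ =
  trans (sumFin-cong λ p → sumFin-distrib-+ (w p) (w′ p)) (sumFin-distrib-+ (sumFin ∘ w) (sumFin ∘ w′))

sumFin²-zero : sumFin² {n} (λ _ _ → 0) ≡ 0
sumFin²-zero {n} = trans (sumFin-cong {n} λ _ → sumFin-zero {n}) (sumFin-zero {n})

term≤sumFin² : (w : Weights n) → ∀ p q → w p q ≤ sumFin² w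
term≤sumFin² w p q = ≤-trans (term≤sumFin (w p) q) (term≤sumFin (sumFin ∘ w) p)

sumFin²-positive : (w : Weights n) → 0 < sumFin² w → ∃[ p ] ∃[ q ] 0 < w p q
sumFin²-positive w pos with sumFin-positive (sumFin ∘ w) pos
... | p , row>0 with sumFin-positive (w p) row>0
...   | q , wpq>0 = p , q , wpq>0

sumFin²-pick : (u v : Fin n) (c : Weights n) →
               sumFin² (λ p q → when (lookup ⁅ u ⁆ p) (when (lookup ⁅ v ⁆ q) (c p q))) ≡ c u v
sumFin²-pick u v c = trans
  (sumFin-cong λ p → trans (sumFin-when (lookup ⁅ u ⁆ p) (λ q → when (lookup ⁅ v ⁆ q) (c p q)))
                            (cong (when (lookup ⁅ u ⁆ p)) (sumFin-pick v (c p))))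
  (sumFin-pick u (λ p → c p v))

sumFin-sumFin² : ∀ {m} (f : Fin m → Weights n) →
                 sumFin (λ j → sumFin² (f j)) ≡ sumFin² (λ p q → sumFin (λ j → f j p q))
sumFin-sumFin² f = trans (sumFin-comm (λ j p → sumFin (f j p)))
                         (sumFin-cong λ p → sumFin-comm (λ j q → f j p q))

sumFin-telescope : (h d : ℕ → ℕ) → (∀ k → h (suc k) ≡ h k + d k) → ∀ l → h l ≡ h 0 + sumFin {l} (d ∘ toℕ)
sumFin-telescope h d h≡ zero    = sym (+-identityʳ (h 0))
sumFin-telescope h d h≡ (suc l) = begin
  h (suc l)                                       ≡⟨ sumFin-telescope (h ∘ suc) (d ∘ suc) (h≡ ∘ suc) l ⟩
  h 1 + sumFin {l} (d ∘ suc ∘ toℕ)                ≡⟨ cong (_+ _) (h≡ 0) ⟩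
  h 0 + d 0 + sumFin {l} (d ∘ suc ∘ toℕ)          ≡⟨ +-assoc (h 0) (d 0) _ ⟩
  h 0 + sumFin {suc l} (d ∘ toℕ)                  ∎
  where open ≡-Reasoning

prodFin-cong : {g h : Fin n → ℕ} → g ≗ h → prodFin g ≡ prodFin h
prodFin-cong {zero}  e = refl
prodFin-cong {suc n} e = cong₂ _*_ (e fz) (prodFin-cong (e ∘ fs))

module ℤ∑ = SemiringSum ℤP.+-*-semiring

sumFinℤ≡sum : (g : Fin n → ℤ) → sumFinℤ g ≡ ℤ∑.sum g
sumFinℤ≡sum {zero}  g = refl
sumFinℤ≡sum {suc n} g = cong (ℤ._+_ (g fz)) (sumFinℤ≡sum (g ∘ fs))

sumFinℤ-cong : {g h : Fin n → ℤ} → g ≗ h → sumFinℤ g ≡ sumFinℤ h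
sumFinℤ-cong {zero}  e = refl
sumFinℤ-cong {suc n} e = cong₂ ℤ._+_ (e fz) (sumFinℤ-cong (e ∘ fs))

sumFinℤ-mono-≤ : {g h : Fin n → ℤ} → (∀ i → g i ℤ.≤ h i) → sumFinℤ g ℤ.≤ sumFinℤ h
sumFinℤ-mono-≤ {zero}  le = ℤP.≤-refl
sumFinℤ-mono-≤ {suc n} le = ℤP.+-mono-≤ (le fz) (sumFinℤ-mono-≤ (le ∘ fs))

sumFinℤ-+ : (g : Fin n → ℕ) → sumFinℤ (λ i → ℤ.+ g i) ≡ ℤ.+ sumFin g
sumFinℤ-+ {zero}  g = refl
sumFinℤ-+ {suc n} g = cong (ℤ._+_ (ℤ.+ g fz)) (sumFinℤ-+ (g ∘ fs))

sumFinℤ-comm : ∀ {m} (f : Fin m → Fin n → ℤ) →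
               sumFinℤ (λ i → sumFinℤ (f i)) ≡ sumFinℤ (λ j → sumFinℤ (λ i → f i j))
sumFinℤ-comm f = begin
  sumFinℤ (λ i → sumFinℤ (f i))               ≡⟨ nested f ⟩
  ℤ∑.sum (λ i → ℤ∑.sum (f i))                 ≡⟨ ℤ∑.∑-comm f ⟩
  ℤ∑.sum (λ j → ℤ∑.sum (λ i → f i j))         ≡⟨ nested (λ j i → f i j) ⟨
  sumFinℤ (λ j → sumFinℤ (λ i → f i j))       ∎
  where
  open ≡-Reasoning
  nested : ∀ {k l} (h : Fin k → Fin l → ℤ) → sumFinℤ (λ i → sumFinℤ (h i)) ≡ ℤ∑.sum (λ i → ℤ∑.sum (h i))
  nested h = trans (sumFinℤ-cong (sumFinℤ≡sum ∘ h)) (sumFinℤ≡sum (λ i → ℤ∑.sum (h i)))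

sumFinℤ-*ˡ : (c : ℤ) (g : Fin n → ℤ) → c ℤ.* sumFinℤ g ≡ sumFinℤ (λ i → c ℤ.* g i)
sumFinℤ-*ˡ c g = trans (cong (ℤ._*_ c) (sumFinℤ≡sum g))
                       (trans (ℤ∑.*-distribˡ-sum c g) (sym (sumFinℤ≡sum (λ i → c ℤ.* g i))))

sumFinℤ-*ʳ : (c : ℤ) (g : Fin n → ℤ) → sumFinℤ g ℤ.* c ≡ sumFinℤ (λ i → g i ℤ.* c)
sumFinℤ-*ʳ c g = trans (cong (λ x → x ℤ.* c) (sumFinℤ≡sum g))
                       (trans (ℤ∑.*-distribʳ-sum c g) (sym (sumFinℤ≡sum (λ i → g i ℤ.* c))))

sumFinℤ-telescope : (h : ℕ → ℤ) → ∀ l → sumFinℤ {l} (λ r → h (suc (toℕ r)) ℤ.- h (toℕ r)) ≡ h l ℤ.- h 0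
sumFinℤ-telescope h zero    = sym (ℤP.+-inverseʳ (h 0))
sumFinℤ-telescope h (suc l) = trans (cong (ℤ._+_ (h 1 ℤ.- h 0)) (sumFinℤ-telescope (h ∘ suc) l))
                                    (consecutive (h 0) (h 1) (h (suc l)))
  where
  consecutive : ∀ x y z → (y ℤ.- x) ℤ.+ (z ℤ.- y) ≡ z ℤ.- x
  consecutive = solve-∀

+[m+n]-+m : ∀ m k → ℤ.+ (m + k) ℤ.- ℤ.+ m ≡ ℤ.+ k
+[m+n]-+m m k = trans (cong (λ x → x ℤ.- ℤ.+ m) (ℤP.pos-+ m k)) (cancel (ℤ.+ m) (ℤ.+ k))
  where
  cancel : ∀ x y → (x ℤ.+ y) ℤ.- x ≡ y
  cancel = solve-∀

-- Coverage functions of multigraphs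

touches : Subset n → Fin n → Fin n → Bool
touches S p q = lookup S p ∨ lookup S q

touches-∪ : (S T : Subset n) (p q : Fin n) → touches (S ∪ T) p q ≡ touches S p q ∨ touches T p q
touches-∪ S T p q = trans (cong₂ _∨_ (lookup-∪ S T p) (lookup-∪ S T q))
                          (∨-interchange (lookup S p) (lookup T p) (lookup S q) (lookup T q))

touches-∩ : (S T : Subset n) (p q : Fin n) →
            touches (S ∩ T) p q ≡ true → touches S p q ∧ touches T p q ≡ true
touches-∩ S T p q rewrite lookup-∩ S T p | lookup-∩ S T q =
  ∧-∨-⇒ (lookup S p) (lookup S q) (lookup T p) (lookup T q)

_↾_ : (Fin n → ℕ) → Subset n → Fin n → ℕ

(X ↾ S) j = when (lookup S j) (X j)

_⇂_ : Weights n → Subset n → Weights n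

(w ⇂ S) p q = when (touches S p q) (w p q)

coverage : Weights n → Subset n → ℕ
coverage w S = sumFin² (w ⇂ S)

point : Fin n → Fin n → ℕ
point h x = when (lookup ⁅ h ⁆ x) 1

edgeAt : Fin n → Fin n → Weights n
edgeAt u v p q = when (lookup ⁅ u ⁆ p) (point v q)

modular-cong : {X Y : Fin n → ℕ} → X ≗ Y → ∀ S → modular X S ≡ modular Y S
modular-cong e S = sumFin-cong λ j → cong (when (lookup S j)) (e j)

modular-distrib-+ : (X Y : Fin n → ℕ) (S : Subset n) →
                    modular (λ x → X x + Y x) S ≡ modular X S + modular Y S
modular-distrib-+ X Y S =
  trans (sumFin-cong λ j → when-distrib-+ (lookup S j) (X j) (Y j)) (sumFin-distrib-+ (X ↾ S) (Y ↾ S))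

modular-point : (h : Fin n) (S : Subset n) → modular (point h) S ≡ when (lookup S h) 1
modular-point h S = trans (sumFin-cong λ j → when-comm (lookup S j) (lookup ⁅ h ⁆ j) 1)
                          (sumFin-pick h (λ j → when (lookup S j) 1))

modular-⊤ : (X : Fin n → ℕ) → modular X ⊤ ≡ sumFin X
modular-⊤ X = sumFin-cong λ j → cong (λ b → when b (X j)) (lookup-⊤ j)

modular-⊤-split : (X : Fin n → ℕ) (h : Fin n) → modular X ⊤ ≡ modular X (∁ ⁅ h ⁆) + X h
modular-⊤-split X h = begin
  modular X ⊤
    ≡⟨ modular-⊤ X ⟩
  sumFin X
    ≡⟨ sumFin-cong (λ j → when-not (lookup ⁅ h ⁆ j) (X j)) ⟩
  sumFin (λ j → when (not (lookup ⁅ h ⁆ j)) (X j) + when (lookup ⁅ h ⁆ j) (X j))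
    ≡⟨ sumFin-distrib-+ (λ j → when (not (lookup ⁅ h ⁆ j)) (X j)) (X ↾ ⁅ h ⁆) ⟩
  sumFin (λ j → when (not (lookup ⁅ h ⁆ j)) (X j)) + sumFin (λ j → when (lookup ⁅ h ⁆ j) (X j))
    ≡⟨ cong₂ _+_ (sumFin-cong λ j → cong (λ b → when b (X j)) (sym (lookup-∁ ⁅ h ⁆ j))) (sumFin-pick h X) ⟩
  modular X (∁ ⁅ h ⁆) + X h
    ∎
  where open ≡-Reasoning

modular-∪-∩ : (X : Fin n → ℕ) (S T : Subset n) →
              modular X (S ∪ T) + modular X (S ∩ T) ≡ modular X S + modular X T
modular-∪-∩ X S T = begin
  modular X (S ∪ T) + modular X (S ∩ T)
    ≡⟨ sumFin-distrib-+ (X ↾ (S ∪ T)) (X ↾ (S ∩ T)) ⟨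
  sumFin (λ j → when (lookup (S ∪ T) j) (X j) + when (lookup (S ∩ T) j) (X j))
    ≡⟨ sumFin-cong (λ j → trans (cong₂ (λ a b → when a (X j) + when b (X j)) (lookup-∪ S T j) (lookup-∩ S T j))
                                (when-∨-∧ (lookup S j) (lookup T j) (X j))) ⟩
  sumFin (λ j → when (lookup S j) (X j) + when (lookup T j) (X j))
    ≡⟨ sumFin-distrib-+ (X ↾ S) (X ↾ T) ⟩
  modular X S + modular X T
    ∎
  where open ≡-Reasoning

coverage-cong : {w w′ : Weights n} → (∀ p q → w p q ≡ w′ p q) → ∀ S → coverage w S ≡ coverage w′ S
coverage-cong e S = sumFin²-cong λ p q → cong (when (touches S p q)) (e p q)

coverage-distrib-+ : (w w′ : Weights n) (S : Subset n) →
                     coverage (λ p q → w p q + w′ p q) S ≡ coverage w S + coverage w′ S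
coverage-distrib-+ w w′ S =
  trans (sumFin²-cong λ p q → when-distrib-+ (touches S p q) (w p q) (w′ p q)) (sumFin²-distrib-+ (w ⇂ S) (w′ ⇂ S))

coverage-⊤ : (w : Weights n) → coverage w ⊤ ≡ sumFin² w
coverage-⊤ w = sumFin²-cong λ p q → cong (λ b → when (b ∨ lookup ⊤ q) (w p q)) (lookup-⊤ p)

coverage-≤-⊤ : (w : Weights n) (S : Subset n) → coverage w S ≤ coverage w ⊤
coverage-≤-⊤ w S = subst (coverage w S ≤_) (sym (coverage-⊤ w))
                         (sumFin²-mono-≤ λ p q → when-≤ (touches S p q) (w p q))

coverage-⊥ : (w : Weights n) → coverage w ⊥ ≡ 0
coverage-⊥ {n} w = trans (sumFin²-cong λ p q → cong₂ (λ a b → when (a ∨ b) (w p q)) (lookup-⊥ p) (lookup-⊥ q))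
                         (sumFin²-zero {n})

coverage-∪-∩-< : (w : Weights n) {S T : Subset n} {u v : Fin n} →
                 lookup S u ≡ true → lookup S v ≡ false → lookup T v ≡ true → lookup T u ≡ false →
                 0 < w u v → coverage w (S ∪ T) + coverage w (S ∩ T) < coverage w S + coverage w T
coverage-∪-∩-< w {S} {T} {u} {v} Su Sv Tv Tu w>0 =
  subst₂ _<_ (sumFin²-distrib-+ (w ⇂ (S ∪ T)) (w ⇂ (S ∩ T))) (sumFin²-distrib-+ (w ⇂ S) (w ⇂ T))
             (sumFin²-mono-< pointwise u v crossing)
  where
  pointwise : ∀ p q → when (touches (S ∪ T) p q) (w p q) + when (touches (S ∩ T) p q) (w p q)
                      ≤ when (touches S p q) (w p q) + when (touches T p q) (w p q)
  pointwise p q = begin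
    when (touches (S ∪ T) p q) (w p q) + when (touches (S ∩ T) p q) (w p q)
      ≤⟨ +-mono-≤ (≤-reflexive (cong (λ b → when b (w p q)) (touches-∪ S T p q)))
                  (when-mono (touches-∩ S T p q) (w p q)) ⟩
    when (touches S p q ∨ touches T p q) (w p q) + when (touches S p q ∧ touches T p q) (w p q)
      ≡⟨ when-∨-∧ (touches S p q) (touches T p q) (w p q) ⟩
    when (touches S p q) (w p q) + when (touches T p q) (w p q) ∎
    where open ≤-Reasoning
  crossing : when (touches (S ∪ T) u v) (w u v) + when (touches (S ∩ T) u v) (w u v)
             < when (touches S u v) (w u v) + when (touches T u v) (w u v)
  crossing rewrite lookup-∪ S T u | lookup-∩ S T u | lookup-∩ S T v | Su | Sv | Tv | Tu =
    +-monoʳ-< (w u v) w>0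

-- Orientations and Hakimi's theorem

point-≤ : {X : Fin n → ℕ} {h : Fin n} → 0 < X h → ∀ x → point h x ≤ X x
point-≤ {X = X} {h} Xh>0 x with lookup ⁅ h ⁆ x in eq
... | true  = subst (λ y → 0 < X y) (sym (lookup-⁅⁆⇒≡ eq)) Xh>0
... | false = z≤n

edgeAt-≤ : {w : Weights n} {u v : Fin n} → 0 < w u v → ∀ p q → edgeAt u v p q ≤ w p q
edgeAt-≤ {w = w} {u} {v} wuv>0 p q with lookup ⁅ u ⁆ p in eqp | lookup ⁅ v ⁆ q in eqq
... | true  | true  = subst₂ (λ p q → 0 < w p q) (sym (lookup-⁅⁆⇒≡ eqp)) (sym (lookup-⁅⁆⇒≡ eqq)) wuv>0
... | true  | false = z≤n
... | false | _     = z≤n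

sumFin²-edgeAt : (t : Fin n → Fin n → Bool) (u v : Fin n) →
                 sumFin² (λ p q → when (t p q) (edgeAt u v p q)) ≡ when (t u v) 1
sumFin²-edgeAt t u v = trans (sumFin²-cong swap) (sumFin²-pick u v (λ p q → when (t p q) 1))
  where
  swap : ∀ p q → when (t p q) (edgeAt u v p q) ≡ when (lookup ⁅ u ⁆ p) (when (lookup ⁅ v ⁆ q) (when (t p q) 1))
  swap p q = trans (when-comm (t p q) (lookup ⁅ u ⁆ p) _)
                   (cong (when (lookup ⁅ u ⁆ p)) (when-comm (t p q) (lookup ⁅ v ⁆ q) 1))

coverage-edgeAt : (u v : Fin n) (S : Subset n) → coverage (edgeAt u v) S ≡ when (touches S u v) 1
coverage-edgeAt u v S = sumFin²-edgeAt (touches S) u v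

headWeight : Weights n → Weights n → Fin n → Weights n
headWeight a b x p q = when (lookup ⁅ x ⁆ p) (a p q) + when (lookup ⁅ x ⁆ q) (b p q)

indegree : Weights n → Weights n → Fin n → ℕ
indegree a b x = sumFin² (headWeight a b x)

record Orientation (w : Weights n) (X : Fin n → ℕ) : Set where
  field
    toSource toTarget : Weights n
    splits            : ∀ p q → toSource p q + toTarget p q ≡ w p q
    indegree≡         : ∀ x → X x ≡ indegree toSource toTarget x

indegree-+edgeAtˢ : (a b : Weights n) (u v x : Fin n) →
                    indegree (λ p q → a p q + edgeAt u v p q) b x ≡ indegree a b x + point u x
indegree-+edgeAtˢ a b u v x = begin
  indegree (λ p q → a p q + edgeAt u v p q) b x
    ≡⟨ sumFin²-cong (λ p q → trans (cong (_+ _) (when-distrib-+ (lookup ⁅ x ⁆ p) (a p q) (edgeAt u v p q)))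
                                   (xy∙z≈xz∙y (when (lookup ⁅ x ⁆ p) (a p q)) (when (lookup ⁅ x ⁆ p) (edgeAt u v p q))
                                               (when (lookup ⁅ x ⁆ q) (b p q)))) ⟩
  sumFin² (λ p q → headWeight a b x p q + when (lookup ⁅ x ⁆ p) (edgeAt u v p q))
    ≡⟨ sumFin²-distrib-+ (headWeight a b x) (λ p q → when (lookup ⁅ x ⁆ p) (edgeAt u v p q)) ⟩
  indegree a b x + sumFin² (λ p q → when (lookup ⁅ x ⁆ p) (edgeAt u v p q))
    ≡⟨ cong (indegree a b x +_) (sumFin²-edgeAt (λ p _ → lookup ⁅ x ⁆ p) u v) ⟩
  indegree a b x + when (lookup ⁅ x ⁆ u) 1
    ≡⟨ cong (λ c → indegree a b x + when c 1) (lookup-⁅⁆-sym x u) ⟩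
  indegree a b x + point u x ∎
  where open ≡-Reasoning

indegree-+edgeAtᵗ : (a b : Weights n) (u v x : Fin n) →
                    indegree a (λ p q → b p q + edgeAt u v p q) x ≡ indegree a b x + point v x
indegree-+edgeAtᵗ a b u v x = begin
  indegree a (λ p q → b p q + edgeAt u v p q) x
    ≡⟨ sumFin²-cong (λ p q → trans (cong (_ +_) (when-distrib-+ (lookup ⁅ x ⁆ q) (b p q) (edgeAt u v p q)))
                                   (sym (+-assoc (when (lookup ⁅ x ⁆ p) (a p q)) (when (lookup ⁅ x ⁆ q) (b p q))
                                                    (when (lookup ⁅ x ⁆ q) (edgeAt u v p q))))) ⟩
  sumFin² (λ p q → headWeight a b x p q + when (lookup ⁅ x ⁆ q) (edgeAt u v p q))
    ≡⟨ sumFin²-distrib-+ (headWeight a b x) (λ p q → when (lookup ⁅ x ⁆ q) (edgeAt u v p q)) ⟩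
  indegree a b x + sumFin² (λ p q → when (lookup ⁅ x ⁆ q) (edgeAt u v p q))
    ≡⟨ cong (indegree a b x +_) (sumFin²-edgeAt (λ _ q → lookup ⁅ x ⁆ q) u v) ⟩
  indegree a b x + when (lookup ⁅ x ⁆ v) 1
    ≡⟨ cong (λ c → indegree a b x + when c 1) (lookup-⁅⁆-sym x v) ⟩
  indegree a b x + point v x ∎
  where open ≡-Reasoning

indegree-zero : (x : Fin n) → indegree (λ _ _ → 0) (λ _ _ → 0) x ≡ 0
indegree-zero {n} x =
  trans (sumFin²-cong λ p q → cong₂ _+_ (when-zero (lookup ⁅ x ⁆ p)) (when-zero (lookup ⁅ x ⁆ q)))
        (sumFin²-zero {n})

headWeight-≤ : (a b : Weights n) (x p q : Fin n) →
               headWeight a b x p q ≤ when (touches ⁅ x ⁆ p q) (a p q + b p q)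
headWeight-≤ a b x p q = when-∨-+ (lookup ⁅ x ⁆ p) (lookup ⁅ x ⁆ q) (a p q) (b p q)

sumFin-headWeight : (a b : Weights n) (p q : Fin n) → sumFin (λ x → headWeight a b x p q) ≡ a p q + b p q
sumFin-headWeight a b p q = trans
  (sumFin-distrib-+ (λ x → when (lookup ⁅ x ⁆ p) (a p q)) (λ x → when (lookup ⁅ x ⁆ q) (b p q)))
  (cong₂ _+_ (pick p (a p q)) (pick q (b p q)))
  where
  pick : ∀ y c → sumFin (λ x → when (lookup ⁅ x ⁆ y) c) ≡ c
  pick y c = trans (sumFin-cong λ x → cong (λ t → when t c) (lookup-⁅⁆-sym x y)) (sumFin-pick y (λ _ → c))

-- A tight set containing o but not h; it forbids orienting an edge between h and o towards h.
Blocking : (Fin n → ℕ) → Weights n → Fin n → Fin n → Subset n → Set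
Blocking X w h o S = lookup S o ≡ true × lookup S h ≡ false × coverage w S ≤ modular X S

blocked? : (X : Fin n → ℕ) (w : Weights n) (h o : Fin n) → Dec (∃ (Blocking X w h o))
blocked? X w h o = anySubset? λ S →
  (lookup S o Bool.≟ true) ×-dec (lookup S h Bool.≟ false) ×-dec (coverage w S ≤? modular X S)

unblocked⇒strict : {X : Fin n → ℕ} {w : Weights n} {h o : Fin n} → ¬ ∃ (Blocking X w h o) →
                   ∀ S → lookup S o ≡ true → lookup S h ≡ false → modular X S < coverage w S
unblocked⇒strict free S So Sh = ≰⇒> λ tight → free (S , So , Sh , tight)

crossing-blocks-impossible : {X : Fin n → ℕ} {w : Weights n} {u v : Fin n} →
  Cover (coverage w) X → 0 < w u v → ∃ (Blocking X w u v) → ∃ (Blocking X w v u) → Empty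
crossing-blocks-impossible {X = X} {w} (_ , cover) wuv>0 (T , Tv , Tu , tightT) (S , Su , Sv , tightS) =
  <-irrefl refl (begin-strict
    modular X (S ∪ T) + modular X (S ∩ T)     ≤⟨ +-mono-≤ (cover (S ∪ T)) (cover (S ∩ T)) ⟩
    coverage w (S ∪ T) + coverage w (S ∩ T)   <⟨ coverage-∪-∩-< w {S} {T} Su Sv Tv Tu wuv>0 ⟩
    coverage w S + coverage w T               ≤⟨ +-mono-≤ tightS tightT ⟩
    modular X S + modular X T                 ≡⟨ modular-∪-∩ X S T ⟨
    modular X (S ∪ T) + modular X (S ∩ T)     ∎)
  where open ≤-Reasoning

-- Orienting one edge between h and o towards h, when no set blocks this: X h > 0, and X − [h] covers
-- the remaining multigraph w′.
module Reorient {w w′ : Weights n} {X : Fin n → ℕ} {h o : Fin n}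
  (coverage-split : ∀ S → coverage w S ≡ coverage w′ S + when (touches S h o) 1)
  (cover : Cover (coverage w) X)
  (unblocked : ∀ S → lookup S o ≡ true → lookup S h ≡ false → modular X S < coverage w S) where

  head-positive : 0 < X h
  head-positive = +-cancelˡ-< (modular X S₀) 0 (X h) (begin-strict
    modular X S₀ + 0                 ≡⟨ +-identityʳ _ ⟩
    modular X S₀                     <⟨ below-total (lookup S₀ o) refl ⟩
    modular X ⊤                      ≡⟨ modular-⊤-split X h ⟩
    modular X S₀ + X h               ∎)
    where
    open ≤-Reasoning
    S₀ : Subset n
    S₀ = ∁ ⁅ h ⁆
    h∉S₀ : lookup S₀ h ≡ false
    h∉S₀ = trans (lookup-∁ ⁅ h ⁆ h) (cong not (lookup-⁅x⁆-x h))
    below-total : ∀ b → lookup S₀ o ≡ b → modular X S₀ < modular X ⊤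
    below-total true  o∈S₀ = begin-strict
      modular X S₀                   <⟨ unblocked S₀ o∈S₀ h∉S₀ ⟩
      coverage w S₀                  ≤⟨ coverage-≤-⊤ w S₀ ⟩
      coverage w ⊤                   ≡⟨ proj₁ cover ⟨
      modular X ⊤                    ∎
    -- Here o = h: the removed edge is a loop at h.
    below-total false o∉S₀ = begin-strict
      modular X S₀                   ≤⟨ proj₂ cover S₀ ⟩
      coverage w S₀                  ≡⟨ coverage-split S₀ ⟩
      coverage w′ S₀ + when (lookup S₀ h ∨ lookup S₀ o) 1
                                     ≡⟨ cong₂ (λ a b → coverage w′ S₀ + when (a ∨ b) 1) h∉S₀ o∉S₀ ⟩
      coverage w′ S₀ + 0             ≤⟨ +-mono-≤ (coverage-≤-⊤ w′ S₀) z≤n ⟩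
      coverage w′ ⊤ + 0              <⟨ +-monoʳ-< (coverage w′ ⊤) (s≤s z≤n) ⟩
      coverage w′ ⊤ + 1              ≡⟨ cong (λ b → coverage w′ ⊤ + when (b ∨ lookup ⊤ o) 1) (lookup-⊤ h) ⟨
      coverage w′ ⊤ + when (lookup ⊤ h ∨ lookup ⊤ o) 1
                                     ≡⟨ coverage-split ⊤ ⟨
      coverage w ⊤                   ≡⟨ proj₁ cover ⟨
      modular X ⊤                    ∎

  X′ : Fin n → ℕ
  X′ x = X x ∸ point h x

  X≗X′+point : ∀ x → X x ≡ X′ x + point h x
  X≗X′+point x = sym (m∸n+n≡m (point-≤ {X = X} {h} head-positive x))

  modular-split : ∀ S → modular X S ≡ modular X′ S + when (lookup S h) 1
  modular-split S = trans (modular-cong X≗X′+point S)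
                          (trans (modular-distrib-+ X′ (point h) S) (cong (modular X′ S +_) (modular-point h S)))

  cover′ : Cover (coverage w′) X′
  cover′ = total , λ S → drop-unit (lookup S h) (lookup S o) (modular-split S) (coverage-split S)
                                     (proj₂ cover S) (unblocked S)
    where
    total : modular X′ ⊤ ≡ coverage w′ ⊤
    total = +-cancelʳ-≡ 1 _ _ (begin
      modular X′ ⊤ + 1                                  ≡⟨ cong (λ b → modular X′ ⊤ + when b 1) (lookup-⊤ h) ⟨
      modular X′ ⊤ + when (lookup ⊤ h) 1                ≡⟨ modular-split ⊤ ⟨
      modular X ⊤                                       ≡⟨ proj₁ cover ⟩
      coverage w ⊤                                      ≡⟨ coverage-split ⊤ ⟩
      coverage w′ ⊤ + when (lookup ⊤ h ∨ lookup ⊤ o) 1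
        ≡⟨ cong (λ b → coverage w′ ⊤ + when (b ∨ lookup ⊤ o) 1) (lookup-⊤ h) ⟩
      coverage w′ ⊤ + 1                                 ∎)
      where open ≡-Reasoning
    drop-unit : ∀ bh bo {m m′ c c′} → m ≡ m′ + when bh 1 → c ≡ c′ + when (bh ∨ bo) 1 →
                m ≤ c → (bo ≡ true → bh ≡ false → m < c) → m′ ≤ c′
    drop-unit true  bo    m≡ c≡ m≤c _   = +-cancelʳ-≤ 1 _ _ (subst₂ _≤_ m≡ c≡ m≤c)
    drop-unit false true  m≡ c≡ _   m<c =
      ≤-pred (subst₂ _<_ (trans m≡ (+-identityʳ _)) (trans c≡ (+-comm _ 1)) (m<c refl refl))
    drop-unit false false m≡ c≡ m≤c _   = subst₂ _≤_ (trans m≡ (+-identityʳ _)) (trans c≡ (+-identityʳ _)) m≤c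

minusEdge : Weights n → Fin n → Fin n → Weights n
minusEdge w u v p q = w p q ∸ edgeAt u v p q

module _ {w : Weights n} {u v : Fin n} (wuv>0 : 0 < w u v) where

  minusEdge-+ : ∀ p q → w p q ≡ minusEdge w u v p q + edgeAt u v p q
  minusEdge-+ p q = sym (m∸n+n≡m (edgeAt-≤ {w = w} wuv>0 p q))

  coverage-minusEdge : ∀ S → coverage w S ≡ coverage (minusEdge w u v) S + when (touches S u v) 1
  coverage-minusEdge S = trans (coverage-cong minusEdge-+ S)
    (trans (coverage-distrib-+ (minusEdge w u v) (edgeAt u v) S)
           (cong (coverage (minusEdge w u v) S +_) (coverage-edgeAt u v S)))

  coverage-minusEdge-⊤ : coverage w ⊤ ≡ suc (coverage (minusEdge w u v) ⊤)
  coverage-minusEdge-⊤ = trans (coverage-minusEdge ⊤)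
    (trans (cong (λ b → coverage (minusEdge w u v) ⊤ + when (b ∨ lookup ⊤ v) 1) (lookup-⊤ u)) (+-comm _ 1))

module _ {w w′ : Weights n} {X X′ : Fin n → ℕ} {u v : Fin n}
  (w≡ : ∀ p q → w p q ≡ w′ p q + edgeAt u v p q) (o : Orientation w′ X′) where
  open Orientation o

  orientToSource : (∀ x → X x ≡ X′ x + point u x) → Orientation w X
  orientToSource X≡ = record
    { toSource  = λ p q → toSource p q + edgeAt u v p q
    ; toTarget  = toTarget
    ; splits    = λ p q → trans (xy∙z≈xz∙y (toSource p q) (edgeAt u v p q) (toTarget p q))
                                (trans (cong (_+ edgeAt u v p q) (splits p q)) (sym (w≡ p q)))
    ; indegree≡ = λ x → trans (X≡ x) (trans (cong (_+ point u x) (indegree≡ x))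
                                           (sym (indegree-+edgeAtˢ toSource toTarget u v x)))
    }

  orientToTarget : (∀ x → X x ≡ X′ x + point v x) → Orientation w X
  orientToTarget X≡ = record
    { toSource  = toSource
    ; toTarget  = λ p q → toTarget p q + edgeAt u v p q
    ; splits    = λ p q → trans (sym (+-assoc (toSource p q) (toTarget p q) (edgeAt u v p q)))
                                (trans (cong (_+ edgeAt u v p q) (splits p q)) (sym (w≡ p q)))
    ; indegree≡ = λ x → trans (X≡ x) (trans (cong (_+ point v x) (indegree≡ x))
                                           (sym (indegree-+edgeAtᵗ toSource toTarget u v x)))
    }

orientation′ : ∀ k {w : Weights n} {X : Fin n → ℕ} → coverage w ⊤ ≡ k → Cover (coverage w) X → Orientation w X
orientation′ zero {w} {X} total (X-total , _) = record
  { toSource  = λ _ _ → 0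
  ; toTarget  = λ _ _ → 0
  ; splits    = λ p q → sym (n≤0⇒n≡0 (subst (w p q ≤_) (trans (sym (coverage-⊤ w)) total) (term≤sumFin² w p q)))
  ; indegree≡ = λ x → trans (n≤0⇒n≡0 (subst (X x ≤_) (trans (sym (modular-⊤ X)) (trans X-total total))
                                                      (term≤sumFin X x)))
                            (sym (indegree-zero x))
  }
orientation′ (suc k) {w} {X} total cover
  with sumFin²-positive w (subst (0 <_) (trans (sym total) (coverage-⊤ w)) (s≤s z≤n))
... | u , v , wuv>0 with blocked? X w u v | blocked? X w v u
...   | no free | _ =
  orientToSource {u = u} {v} (minusEdge-+ {w = w} wuv>0) (orientation′ k total′ cover′) X≗X′+point
  where
  open Reorient (coverage-minusEdge {w = w} wuv>0) cover (unblocked⇒strict free)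
  total′ : coverage (minusEdge w u v) ⊤ ≡ k
  total′ = suc-injective (trans (sym (coverage-minusEdge-⊤ {w = w} wuv>0)) total)
...   | yes _ | no free =
  orientToTarget {u = u} {v} (minusEdge-+ {w = w} wuv>0) (orientation′ k total′ cover′) X≗X′+point
  where
  split : ∀ S → coverage w S ≡ coverage (minusEdge w u v) S + when (touches S v u) 1
  split S = trans (coverage-minusEdge {w = w} wuv>0 S)
                  (cong (λ b → coverage (minusEdge w u v) S + when b 1) (Bool.∨-comm (lookup S u) (lookup S v)))
  open Reorient split cover (unblocked⇒strict free)
  total′ : coverage (minusEdge w u v) ⊤ ≡ k
  total′ = suc-injective (trans (sym (coverage-minusEdge-⊤ {w = w} wuv>0)) total)
...   | yes blockedᵤ | yes blockedᵥ = ⊥-elim (crossing-blocks-impossible cover wuv>0 blockedᵤ blockedᵥ)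

orientation : {w : Weights n} {X : Fin n → ℕ} → Cover (coverage w) X → Orientation w X
orientation = orientation′ _ refl

-- Greedy chains

newly : Subset n → Subset n → Fin n → Fin n → Bool
newly S S′ p q = not (touches S p q) ∧ touches S′ p q

gain : Weights n → Subset n → Subset n → ℕ
gain w S S′ = sumFin² λ p q → when (newly S S′ p q) (w p q)

gainAt : Weights n → Subset n → Subset n → Fin n → ℕ
gainAt w S S′ j = sumFin² λ p q → when (newly S S′ p q ∧ touches ⁅ j ⁆ p q) (w p q)

coverage-⊆ : (w : Weights n) {S S′ : Subset n} → S ⊆ S′ → coverage w S′ ≡ coverage w S + gain w S S′
coverage-⊆ w {S} {S′} S⊆S′ = trans
  (sumFin²-cong λ p q → when-split (∨-mono (⊆⇒lookup S⊆S′) (⊆⇒lookup S⊆S′)) (w p q))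
  (sumFin²-distrib-+ (w ⇂ S) (λ p q → when (newly S S′ p q) (w p q)))

gain-split : (w : Weights n) (S S′ : Subset n) (j : Fin n) →
             gain w S S′ ≡ gain w (S ∪ ⁅ j ⁆) (S′ ∪ ⁅ j ⁆) + gainAt w S S′ j
gain-split w S S′ j = trans (sumFin²-cong pointwise)
  (sumFin²-distrib-+ (λ p q → when (newly (S ∪ ⁅ j ⁆) (S′ ∪ ⁅ j ⁆) p q) (w p q))
                     (λ p q → when (newly S S′ p q ∧ touches ⁅ j ⁆ p q) (w p q)))
  where
  pointwise : ∀ p q → when (newly S S′ p q) (w p q)
              ≡ when (newly (S ∪ ⁅ j ⁆) (S′ ∪ ⁅ j ⁆) p q) (w p q) + when (newly S S′ p q ∧ touches ⁅ j ⁆ p q) (w p q)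
  pointwise p q rewrite touches-∪ S ⁅ j ⁆ p q | touches-∪ S′ ⁅ j ⁆ p q =
    when-split-∨ (touches S p q) (touches S′ p q) (touches ⁅ j ⁆ p q) (w p q)

full-coverage⇒⇂-id : (w : Weights n) (S : Subset n) → coverage w S ≡ coverage w ⊤ → ∀ p q → (w ⇂ S) p q ≡ w p q
full-coverage⇒⇂-id w S full p = sumFin-≤-cancel (λ q → when-≤ (touches S p q) (w p q))
  (≤-reflexive (sym (sumFin-≤-cancel (λ p → sumFin-mono-≤ λ q → when-≤ (touches S p q) (w p q))
                                     (≤-reflexive (sym (trans full (coverage-⊤ w)))) p)))

W-⊆ : (seq : List (Fin n)) (k : ℕ) → W seq k ⊆ W seq (suc k)
W-⊆ []       zero    x∈ = x∈
W-⊆ []       (suc k) x∈ = x∈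
W-⊆ (i ∷ xs) zero    x∈ = ⊥⊆ x∈
W-⊆ (i ∷ xs) (suc k) x∈ = x∈p∪q⁺ (Sum.map₂ (W-⊆ xs k) (x∈p∪q⁻ ⁅ i ⁆ (W xs k) x∈))

W-length : (seq : List (Fin n)) → W seq (length seq) ≡ setOf seq
W-length seq = cong setOf (take-all (length seq) seq ≤-refl)

sumFin-newly-chain : (seq : List (Fin n)) (p q : Fin n) (c : ℕ) →
  sumFin {length seq} (λ r → when (newly (W seq (toℕ r)) (W seq (suc (toℕ r))) p q) c)
    ≡ when (touches (setOf seq) p q) c
sumFin-newly-chain seq p q c = begin
  sumFin {length seq} (d ∘ toℕ)          ≡⟨ cong (_+ sumFin {length seq} (d ∘ toℕ)) untouched ⟩
  h 0 + sumFin {length seq} (d ∘ toℕ)    ≡⟨ sumFin-telescope h d grow (length seq) ⟨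
  h (length seq)                         ≡⟨ cong (λ S → when (touches S p q) c) (W-length seq) ⟩
  when (touches (setOf seq) p q) c       ∎
  where
  open ≡-Reasoning
  h d : ℕ → ℕ
  h k = when (touches (W seq k) p q) c
  d k = when (newly (W seq k) (W seq (suc k)) p q) c
  grow : ∀ k → h (suc k) ≡ h k + d k
  grow k = when-split (∨-mono (⊆⇒lookup (W-⊆ seq k)) (⊆⇒lookup (W-⊆ seq k))) c
  untouched : 0 ≡ h 0
  untouched = sym (cong₂ (λ s t → when (s ∨ t) c) (lookup-⊥ p) (lookup-⊥ q))

greedy-from-reaches-top : {f : Subset n → ℕ} {S : Subset n} {xs : List (Fin n)} →
                          GreedyFrom f S xs → f (S ∪ setOf xs) ≡ f ⊤
greedy-from-reaches-top {f = f} {S} (done reached) = trans (cong f (∪-identityʳ S)) reached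
greedy-from-reaches-top {f = f} {S} (step {i = i} {rest} _ _ _ run) =
  trans (cong f (sym (∪-assoc S ⁅ i ⁆ (setOf rest)))) (greedy-from-reaches-top run)

greedy-reaches-top : {f : Subset n → ℕ} {seq : List (Fin n)} → GreedyRun f seq → f (setOf seq) ≡ f ⊤
greedy-reaches-top {f = f} {seq} run = trans (cong f (sym (∪-identityˡ (setOf seq)))) (greedy-from-reaches-top run)

module _ (w : Weights n) (seq : List (Fin n)) (r : Fin (length seq)) where
  private
    Wᵣ Wᵣ₊₁ : Subset n
    Wᵣ   = W seq (toℕ r)
    Wᵣ₊₁ = W seq (suc (toℕ r))

  Δ-coverage : Δ (coverage w) seq r ≡ ℤ.+ gain w Wᵣ Wᵣ₊₁
  Δ-coverage = trans (cong (λ c → ℤ.+ c ℤ.- ℤ.+ coverage w Wᵣ) (coverage-⊆ w (W-⊆ seq (toℕ r))))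
                     (+[m+n]-+m (coverage w Wᵣ) (gain w Wᵣ Wᵣ₊₁))

  aCoef-coverage : ∀ j → aCoef (coverage w) seq r j ≡ ℤ.+ gainAt w Wᵣ Wᵣ₊₁ j
  aCoef-coverage j = begin
    Δ (coverage w) seq r ℤ.- (ℤ.+ coverage w (Wᵣ₊₁ ∪ ⁅ j ⁆) ℤ.- ℤ.+ coverage w (Wᵣ ∪ ⁅ j ⁆))
      ≡⟨ cong₂ ℤ._-_ Δ-coverage (trans (cong (λ c → ℤ.+ c ℤ.- ℤ.+ coverage w (Wᵣ ∪ ⁅ j ⁆))
                                             (coverage-⊆ w (⊆-∪ (W-⊆ seq (toℕ r)) ⁅ j ⁆)))
                                       (+[m+n]-+m (coverage w (Wᵣ ∪ ⁅ j ⁆)) (gain w (Wᵣ ∪ ⁅ j ⁆) (Wᵣ₊₁ ∪ ⁅ j ⁆)))) ⟩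
    ℤ.+ gain w Wᵣ Wᵣ₊₁ ℤ.- ℤ.+ gain w (Wᵣ ∪ ⁅ j ⁆) (Wᵣ₊₁ ∪ ⁅ j ⁆)
      ≡⟨ cong (λ c → ℤ.+ c ℤ.- ℤ.+ gain w (Wᵣ ∪ ⁅ j ⁆) (Wᵣ₊₁ ∪ ⁅ j ⁆)) (gain-split w Wᵣ Wᵣ₊₁ j) ⟩
    ℤ.+ (gain w (Wᵣ ∪ ⁅ j ⁆) (Wᵣ₊₁ ∪ ⁅ j ⁆) + gainAt w Wᵣ Wᵣ₊₁ j) ℤ.- ℤ.+ gain w (Wᵣ ∪ ⁅ j ⁆) (Wᵣ₊₁ ∪ ⁅ j ⁆)
      ≡⟨ +[m+n]-+m (gain w (Wᵣ ∪ ⁅ j ⁆) (Wᵣ₊₁ ∪ ⁅ j ⁆)) (gainAt w Wᵣ Wᵣ₊₁ j) ⟩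
    ℤ.+ gainAt w Wᵣ Wᵣ₊₁ j ∎
    where open ≡-Reasoning

module _ {w : Weights n} {a b : Weights n} (splits : ∀ p q → a p q + b p q ≡ w p q) where

  -- For S = W_{r-1} and S′ = W_r this is Z_r^j: the edges first covered at step r, counted by
  -- their part with head j.
  gainToward : Subset n → Subset n → Fin n → ℕ
  gainToward S S′ j = sumFin² λ p q → when (newly S S′ p q) (headWeight a b j p q)

  sumFin-gainToward : (S S′ : Subset n) → sumFin (gainToward S S′) ≡ gain w S S′
  sumFin-gainToward S S′ = trans (sumFin-sumFin² λ j p q → when (newly S S′ p q) (headWeight a b j p q))
    (sumFin²-cong λ p q → trans (sumFin-when (newly S S′ p q) (λ j → headWeight a b j p q))
                                (cong (when (newly S S′ p q)) (trans (sumFin-headWeight a b p q) (splits p q))))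

  gainToward-≤-gainAt : (S S′ : Subset n) (j : Fin n) → gainToward S S′ j ≤ gainAt w S S′ j
  gainToward-≤-gainAt S S′ j = sumFin²-mono-≤ λ p q → begin
    when (newly S S′ p q) (headWeight a b j p q)
      ≤⟨ when-monoʳ (newly S S′ p q) (headWeight-≤ a b j p q) ⟩
    when (newly S S′ p q) (when (touches ⁅ j ⁆ p q) (a p q + b p q))
      ≡⟨ when-∧ (newly S S′ p q) (touches ⁅ j ⁆ p q) (a p q + b p q) ⟨
    when (newly S S′ p q ∧ touches ⁅ j ⁆ p q) (a p q + b p q)
      ≡⟨ cong (when (newly S S′ p q ∧ touches ⁅ j ⁆ p q)) (splits p q) ⟩
    when (newly S S′ p q ∧ touches ⁅ j ⁆ p q) (w p q) ∎
    where open ≤-Reasoning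

  sumFin-gainToward-chain : (seq : List (Fin n)) → coverage w (setOf seq) ≡ coverage w ⊤ → ∀ j →
    sumFin {length seq} (λ r → gainToward (W seq (toℕ r)) (W seq (suc (toℕ r))) j) ≡ indegree a b j
  sumFin-gainToward-chain seq full j = begin
    sumFin {length seq} (λ r → gainToward (W seq (toℕ r)) (W seq (suc (toℕ r))) j)
      ≡⟨ sumFin-sumFin² {m = length seq} (λ r p q → when (newly (W seq (toℕ r)) (W seq (suc (toℕ r))) p q)
                                                         (headWeight a b j p q)) ⟩
    sumFin² (λ p q → sumFin {length seq} (λ r → when (newly (W seq (toℕ r)) (W seq (suc (toℕ r))) p q)
                                                     (headWeight a b j p q)))
      ≡⟨ sumFin²-cong (λ p q → sumFin-newly-chain seq p q (headWeight a b j p q)) ⟩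
    sumFin² (λ p q → when (touches (setOf seq) p q) (headWeight a b j p q))
      ≡⟨ sumFin²-cong (λ p q → when-absorbs (touches (setOf seq) p q) (headWeight≤w p q)
                                            (full-coverage⇒⇂-id w (setOf seq) full p q)) ⟩
    indegree a b j ∎
    where
    open ≡-Reasoning
    headWeight≤w : ∀ p q → headWeight a b j p q ≤ w p q
    headWeight≤w p q = ≤-trans (headWeight-≤ a b j p q)
                               (≤-trans (when-≤ (touches ⁅ j ⁆ p q) (a p q + b p q)) (≤-reflexive (splits p q)))

-- Minimum-entropy covers

vecsBoundedBy : ℕ → ∀ n → List (Vec ℕ n)
vecsBoundedBy B zero    = [] ∷ []
vecsBoundedBy B (suc n) = cartesianProductWith _∷_ (upTo (suc B)) (vecsBoundedBy B n)

∈-vecsBoundedBy : ∀ {B} (v : Vec ℕ n) → (∀ i → lookup v i ≤ B) → v ∈ vecsBoundedBy B n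
∈-vecsBoundedBy []      _       = here refl
∈-vecsBoundedBy (x ∷ v) bounded =
  ∈-cartesianProductWith⁺ _∷_ (∈-upTo⁺ (s≤s (bounded fz))) (∈-vecsBoundedBy v (bounded ∘ fs))

allSubsets? : {P : Subset n → Set} → (∀ S → Dec (P S)) → Dec (∀ S → P S)
allSubsets? P? = map′ (λ ¬counterexample S → decidable-stable (P? S) (¬counterexample ∘ (S ,_)))
                      (λ all (S , ¬PS) → ¬PS (all S))
                      (¬? (anySubset? (¬? ∘ P?)))

cover? : (f : Subset n → ℕ) (X : Fin n → ℕ) → Dec (Cover f X)
cover? f X = (modular X ⊤ ≟ f ⊤) ×-dec allSubsets? (λ S → modular X S ≤? f S)

Cover-resp-≗ : {f : Subset n → ℕ} {X Y : Fin n → ℕ} → X ≗ Y → Cover f X → Cover f Y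
Cover-resp-≗ X≗Y (total , bounded) =
  trans (sym (modular-cong X≗Y ⊤)) total , λ S → subst (_≤ _) (modular-cong X≗Y S) (bounded S)

Cover-resp : {f g : Subset n → ℕ} {X : Fin n → ℕ} → (∀ S → f S ≡ g S) → Cover f X → Cover g X
Cover-resp f≡g (total , bounded) = trans total (f≡g ⊤) , λ S → subst (_ ≤_) (f≡g S) (bounded S)

cover-entry-≤ : {f : Subset n → ℕ} {X : Fin n → ℕ} → Cover f X → ∀ j → X j ≤ f ⊤
cover-entry-≤ {X = X} (total , _) j = subst (X j ≤_) (trans (sym (modular-⊤ X)) total) (term≤sumFin X j)

minEntropyCover-exists : (f : Subset n → ℕ) {X₀ : Fin n → ℕ} → Cover f X₀ → Σ (Fin n → ℕ) (MinEntropyCover f)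
minEntropyCover-exists {n} f {X₀} cover₀ = lookup best , best-cover , best-maximal
  where
  weight : Vec ℕ n → ℕ
  weight = entropyWeight ∘ lookup
  candidates : List (Vec ℕ n)
  candidates = filter (cover? f ∘ lookup) (vecsBoundedBy (f ⊤) n)
  best : Vec ℕ n
  best = argmax weight (tabulate X₀) candidates
  best-cover : Cover f (lookup best)
  best-cover = argmax-all weight (Cover-resp-≗ (sym ∘ lookup∘tabulate X₀) cover₀)
                                 (all-filter (cover? f ∘ lookup) (vecsBoundedBy (f ⊤) n))
  best-maximal : ∀ Y → Cover f Y → entropyWeight Y ≤ entropyWeight (lookup best)
  best-maximal Y cover =
    subst (_≤ entropyWeight (lookup best)) (prodFin-cong λ j → cong (λ x → x ^ x) (lookup∘tabulate Y j))
    (All.lookup (f[xs]≤f[argmax] {f = weight} (tabulate X₀) candidates)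
      (∈-filter⁺ (cover? f ∘ lookup)
        (∈-vecsBoundedBy (tabulate Y) λ j → subst (_≤ f ⊤) (sym (lookup∘tabulate Y j)) (cover-entry-≤ cover j))
        (Cover-resp-≗ (sym ∘ lookup∘tabulate Y) cover)))

sourceDegree-cover : (w : Weights n) → Cover (coverage w) (λ p → sumFin (w p))
sourceDegree-cover w =
  trans (modular-⊤ (λ p → sumFin (w p))) (sym (coverage-⊤ w)) , λ S → sumFin-mono-≤ λ p → below S p
  where
  below : ∀ S p → when (lookup S p) (sumFin (w p)) ≤ sumFin ((w ⇂ S) p)
  below S p with lookup S p
  ... | true  = ≤-refl
  ... | false = z≤n

-- The covering coefficient

admissible-one : (w : Weights n) (seq : List (Fin n)) {X : Fin n → ℕ} →
                 coverage w (setOf seq) ≡ coverage w ⊤ → MinEntropyCover (coverage w) X →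
                 Admissible (coverage w) seq 1 1
admissible-one {n} w seq {X} full minimal@(cover , _) = X , minimal , Z , bounds , columns , rows
  where
  open Orientation (orientation cover)
  Zᴺ : Fin (length seq) → Fin n → ℕ
  Zᴺ r = gainToward splits (W seq (toℕ r)) (W seq (suc (toℕ r)))
  Z : Fin (length seq) → Fin n → ℤ
  Z r j = ℤ.+ Zᴺ r j
  bounds : ∀ r j → (ℤ.+ 0 ℤ.≤ Z r j) × (Z r j ℤ.≤ aCoef (coverage w) seq r j)
  bounds r j = +≤+ z≤n , subst (Z r j ℤ.≤_) (sym (aCoef-coverage w seq r j))
                                (+≤+ (gainToward-≤-gainAt splits (W seq (toℕ r)) (W seq (suc (toℕ r))) j))
  columns : ∀ j → sumFinℤ (λ r → Z r j) ≡ ℤ.+ X j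
  columns j = trans (sumFinℤ-+ (λ r → Zᴺ r j))
                    (cong ℤ.+_ (trans (sumFin-gainToward-chain splits seq full j) (sym (indegree≡ j))))
  rows : ∀ r → sumFinℤ (Z r) ℤ.* ℤ.+ 1 ℤ.≤ ℤ.+ 1 ℤ.* Δ (coverage w) seq r
  rows r = ℤP.≤-reflexive (begin
    sumFinℤ (Z r) ℤ.* ℤ.+ 1             ≡⟨ ℤP.*-identityʳ _ ⟩
    sumFinℤ (Z r)                       ≡⟨ sumFinℤ-+ (Zᴺ r) ⟩
    ℤ.+ sumFin (Zᴺ r)                   ≡⟨ cong ℤ.+_ (sumFin-gainToward splits (W seq (toℕ r)) (W seq (suc (toℕ r)))) ⟩
    ℤ.+ gain w (W seq (toℕ r)) (W seq (suc (toℕ r)))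
                                        ≡⟨ Δ-coverage w seq r ⟨
    Δ (coverage w) seq r                ≡⟨ ℤP.*-identityˡ _ ⟨
    ℤ.+ 1 ℤ.* Δ (coverage w) seq r      ∎)
    where open ≡-Reasoning

no-admissible-below-one : {f : Subset n → ℕ} {seq : List (Fin n)} {p q : ℕ} →
  f ⊥ ≡ 0 → 0 < f ⊤ → f (setOf seq) ≡ f ⊤ → p < q → ¬ Admissible f seq p q
no-admissible-below-one {f = f} {seq} {p} {q} f⊥≡0 f⊤>0 reach p<q (X , ((X-total , _) , _) , Z , _ , columns , rows) =
  <⇒≱ (*-monoˡ-< (f ⊤) {{>-nonZero f⊤>0}} p<q) (subst (_≤ p * f ⊤) (*-comm (f ⊤) q) (ℤP.drop‿+≤+ summed))
  where
  entries : sumFinℤ (λ r → sumFinℤ (Z r)) ≡ ℤ.+ f ⊤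
  entries = begin
    sumFinℤ (λ r → sumFinℤ (Z r))               ≡⟨ sumFinℤ-comm Z ⟩
    sumFinℤ (λ j → sumFinℤ (λ r → Z r j))       ≡⟨ sumFinℤ-cong columns ⟩
    sumFinℤ (λ j → ℤ.+ X j)                     ≡⟨ sumFinℤ-+ X ⟩
    ℤ.+ sumFin X                                ≡⟨ cong ℤ.+_ (trans (sym (modular-⊤ X)) X-total) ⟩
    ℤ.+ f ⊤                                     ∎
    where open ≡-Reasoning
  increments : sumFinℤ (Δ f seq) ≡ ℤ.+ f ⊤
  increments = begin
    sumFinℤ (Δ f seq)                           ≡⟨ sumFinℤ-telescope (λ k → ℤ.+ f (W seq k)) (length seq) ⟩
    ℤ.+ f (W seq (length seq)) ℤ.- ℤ.+ f ⊥
      ≡⟨ cong₂ (λ a b → ℤ.+ a ℤ.- ℤ.+ b) (trans (cong f (W-length seq)) reach) f⊥≡0 ⟩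
    ℤ.+ f ⊤ ℤ.- ℤ.+ 0                           ≡⟨ ℤP.+-identityʳ _ ⟩
    ℤ.+ f ⊤                                     ∎
    where open ≡-Reasoning
  summed : ℤ.+ (f ⊤ * q) ℤ.≤ ℤ.+ (p * f ⊤)
  summed = begin
    ℤ.+ (f ⊤ * q)                               ≡⟨ ℤP.pos-* (f ⊤) q ⟩
    ℤ.+ f ⊤ ℤ.* ℤ.+ q                           ≡⟨ cong (λ x → x ℤ.* ℤ.+ q) entries ⟨
    sumFinℤ (λ r → sumFinℤ (Z r)) ℤ.* ℤ.+ q     ≡⟨ sumFinℤ-*ʳ (ℤ.+ q) (λ r → sumFinℤ (Z r)) ⟩
    sumFinℤ (λ r → sumFinℤ (Z r) ℤ.* ℤ.+ q)     ≤⟨ sumFinℤ-mono-≤ rows ⟩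
    sumFinℤ (λ r → ℤ.+ p ℤ.* Δ f seq r)         ≡⟨ sumFinℤ-*ˡ (ℤ.+ p) (Δ f seq) ⟨
    ℤ.+ p ℤ.* sumFinℤ (Δ f seq)                 ≡⟨ cong (ℤ._*_ (ℤ.+ p)) increments ⟩
    ℤ.+ p ℤ.* ℤ.+ f ⊤                           ≡⟨ ℤP.pos-* p (f ⊤) ⟨
    ℤ.+ (p * f ⊤)                               ∎
    where open ℤP.≤-Reasoning

Admissible-resp : {f g : Subset n → ℕ} {seq : List (Fin n)} {p q : ℕ} →
                  (∀ S → f S ≡ g S) → Admissible f seq p q → Admissible g seq p q
Admissible-resp {f = f} {g} {seq} {p} {q} f≡g (X , (cover , minimal) , Z , bounds , columns , rows) =
  X , (Cover-resp f≡g cover , λ Y → minimal Y ∘ Cover-resp (sym ∘ f≡g)) , Z ,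
  (λ r j → proj₁ (bounds r j) , subst (Z r j ℤ.≤_) (aCoef-resp r j) (proj₂ (bounds r j))) ,
  columns ,
  (λ r → subst (λ d → sumFinℤ (Z r) ℤ.* ℤ.+ q ℤ.≤ ℤ.+ p ℤ.* d) (Δ-resp r) (rows r))
  where
  difference-resp : ∀ S T → ℤ.+ f S ℤ.- ℤ.+ f T ≡ ℤ.+ g S ℤ.- ℤ.+ g T
  difference-resp S T = cong₂ (λ a b → ℤ.+ a ℤ.- ℤ.+ b) (f≡g S) (f≡g T)
  Δ-resp : ∀ r → Δ f seq r ≡ Δ g seq r
  Δ-resp r = difference-resp _ _
  aCoef-resp : ∀ r j → aCoef f seq r j ≡ aCoef g seq r j
  aCoef-resp r j = cong₂ ℤ._-_ (Δ-resp r) (difference-resp _ _)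

edgeWeight : Graph n → Weights n
edgeWeight G p q = when ((toℕ p <ᵇ toℕ q) ∧ adj G p q) 1

edgeFn≡coverage : (G : Graph n) (S : Subset n) → edgeFn G S ≡ coverage (edgeWeight G) S
edgeFn≡coverage G S = sumFin²-cong λ p q → indicator (toℕ p <ᵇ toℕ q) (adj G p q) (touches S p q)
  where
  indicator : ∀ c d t → when (c ∧ d ∧ t) 1 ≡ when t (when (c ∧ d) 1)
  indicator true  true  t = refl
  indicator true  false t = sym (when-zero t)
  indicator false d     t = sym (when-zero t)

edgeFn-⊥ : (G : Graph n) → edgeFn G ⊥ ≡ 0
edgeFn-⊥ G = trans (edgeFn≡coverage G ⊥) (coverage-⊥ (edgeWeight G))

edgeWeight-positive : (G : Graph n) → HasEdge G → ∃[ p ] ∃[ q ] 0 < edgeWeight G p q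
edgeWeight-positive G (i , j , i~j) with <-cmp (toℕ i) (toℕ j)
... | tri< i<j _ _ = i , j , subst (λ b → 0 < when (b ∧ adj G i j) 1) (sym (Equivalence.to Bool.T-≡ (<⇒<ᵇ i<j)))
                                   (subst (λ b → 0 < when b 1) (sym i~j) (s≤s z≤n))
... | tri≈ _ i≡j _ =
  contradiction (trans (sym i~j) (subst (λ k → adj G i k ≡ false) (toℕ-injective i≡j) (irreflexive G i))) λ ()
... | tri> _ _ j<i = j , i , subst (λ b → 0 < when (b ∧ adj G j i) 1) (sym (Equivalence.to Bool.T-≡ (<⇒<ᵇ j<i)))
                                   (subst (λ b → 0 < when b 1) (sym (trans (symmetric G j i) i~j)) (s≤s z≤n))

edgeFn-⊤-positive : (G : Graph n) → HasEdge G → 0 < edgeFn G ⊤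
edgeFn-⊤-positive G edge with edgeWeight-positive G edge
... | p , q , wpq>0 = subst (0 <_) (sym (trans (edgeFn≡coverage G ⊤) (coverage-⊤ (edgeWeight G))))
                            (≤-trans wpq>0 (term≤sumFin² (edgeWeight G) p q))

proposition4 : ∀ {n} (G : Graph n) → HasEdge G →
    (seq : List (Fin n)) → GreedyRun (edgeFn G) seq →
    CoveringCoefficientIsOne (edgeFn G) seq
proposition4 {n} G edge seq run =
    Admissible-resp {p = 1} {q = 1} (sym ∘ edgeFn≡coverage G) (admissible-one w seq reachᶜ (proj₂ minimalCover))
  , λ _ _ _ p<q → no-admissible-below-one (edgeFn-⊥ G) (edgeFn-⊤-positive G edge) reach p<q
  where
  w : Weights n
  w = edgeWeight G
  minimalCover : Σ (Fin n → ℕ) (MinEntropyCover (coverage w))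
  minimalCover = minEntropyCover-exists (coverage w) (sourceDegree-cover w)
  reach : edgeFn G (setOf seq) ≡ edgeFn G ⊤
  reach = greedy-reaches-top run
  reachᶜ : coverage w (setOf seq) ≡ coverage w ⊤
  reachᶜ = trans (sym (edgeFn≡coverage G (setOf seq))) (trans reach (edgeFn≡coverage G ⊤))
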